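{- Let $S^{(1)}(n)$ denote the number of secondary structures of rank $1$ on $n$ vertices. Then the sequence $(S^{(1)}(n))_{n\geq 0}$ is log-convex, i.e. $S^{(1)}(n)^2 \le S^{(1)}(n-1)\,S^{(1)}(n+1)$ for all $n\ge 1$.
   Context: For $n\ge 0$, a secondary structure of rank $1$ on the vertex set $[n]=\{1,\dots,n\}$ is a set of arcs, each arc being a pair $\{i,j\}$ with $i<j$ and $j-i>1$, such that no vertex belongs to two arcs and no two arcs cross (there are no arcs $\{i,j\},\{k,l\}$ with $i<k<j<l$); nested arcs are allowed. (Equivalently it is a planar graph on $[n]$ consisting of the segments $[i,i+1]$ together with such arcs drawn in the upper half-plane.) $S^{(1)}(n)$ is the number of such structures; in particular $S^{(1)}(0)=S^{(1)}(1)=S^{(1)}(2)=1$, $S^{(1)}(3)=2$. A sequence $(a_n)$ of positive reals is log-convex if $a_n^2\le a_{n-1}a_{n+1}$ for all $n\ge1$. -}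

module Defs where

open import Data.Nat using (ℕ; zero; suc; _+_; _<_; _≤_; _*_)
open import Data.Nat.Properties using (_<?_)
open import Data.Fin using (Fin; toℕ)
open import Data.Fin.Properties using (all?)
open import Data.Maybe using (Maybe; just; nothing)
open import Data.Vec using (Vec; []; _∷_; lookup)
open import Data.List using (List; []; _∷_; map; concatMap; filter; length; allFin)
open import Data.Product using (_×_)
open import Relation.Binary.PropositionalEquality using (_≡_)
open import Relation.Nullary using (Dec; yes; no; ¬_)
open import Relation.Nullary.Decidable using (_×-dec_; ¬?)
open import Relation.Unary using (Decidable)
open import Data.Sum using (_⊎_)

-- Vertex set [n] is modelled by Fin n (vertex i+1 ↔ index i; only the order matters).
-- A rank-1 secondary structure on [n] is encoded by its partner map
-- p : Vec (Maybe (Fin n)) n, where p[i] = just j  iff {i,j} is an arc and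
-- p[i] = nothing iff i is unpaired.  This is a bijection with arc sets in
-- which no vertex lies on two arcs.

Arc : {n : ℕ} → Vec (Maybe (Fin n)) n → Fin n → Fin n → Set
Arc p i j = (toℕ i < toℕ j) × (lookup p i ≡ just j)

Symmetric : {n : ℕ} → Vec (Maybe (Fin n)) n → Set
Symmetric {n} p = (i j : Fin n) → lookup p i ≡ just j → lookup p j ≡ just i

LongArcs : {n : ℕ} → Vec (Maybe (Fin n)) n → Set
LongArcs {n} p = (i j : Fin n) → lookup p i ≡ just j →
  (suc (toℕ i) < toℕ j) ⊎ (suc (toℕ j) < toℕ i)

NonCrossing : {n : ℕ} → Vec (Maybe (Fin n)) n → Set
NonCrossing {n} p = (i j k l : Fin n) → Arc p i j → Arc p k l →
  ¬ ((toℕ i < toℕ k) × (toℕ k < toℕ j) × (toℕ j < toℕ l))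

IsSecStruct1 : {n : ℕ} → Vec (Maybe (Fin n)) n → Set
IsSecStruct1 p = Symmetric p × LongArcs p × NonCrossing p

open import Data.Maybe.Properties using (≡-dec)
import Data.Fin.Properties as FP

_≟M_ : {n : ℕ} → (a b : Maybe (Fin n)) → Dec (a ≡ b)
_≟M_ = ≡-dec FP._≟_

open import Data.Sum using (inj₁; inj₂)
open import Data.Product using (_,_)
open import Relation.Nullary using (Dec)

⊎-dec : {A B : Set} → Dec A → Dec B → Dec (A ⊎ B)
⊎-dec (yes a) _ = yes (inj₁ a)
⊎-dec (no _) (yes b) = yes (inj₂ b)
⊎-dec (no ¬a) (no ¬b) = no λ { (inj₁ a) → ¬a a ; (inj₂ b) → ¬b b }

→-dec : {A B : Set} → Dec A → Dec B → Dec (A → B)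
→-dec (yes a) (yes b) = yes (λ _ → b)
→-dec (yes a) (no ¬b) = no λ f → ¬b (f a)
→-dec (no ¬a) _ = yes λ a → Data.Empty.⊥-elim (¬a a)
  where import Data.Empty

isSecStruct1? : {n : ℕ} → Decidable (IsSecStruct1 {n})
isSecStruct1? p =
  all? (λ i → all? (λ j → →-dec (lookup p i ≟M just j) (lookup p j ≟M just i)))
  ×-dec
  all? (λ i → all? (λ j → →-dec (lookup p i ≟M just j)
                              (⊎-dec (suc (toℕ i) <? toℕ j) (suc (toℕ j) <? toℕ i))))
  ×-dec
  all? (λ i → all? (λ j → all? (λ k → all? (λ l →
    →-dec (toℕ i <? toℕ j ×-dec (lookup p i ≟M just j))
      (→-dec (toℕ k <? toℕ l ×-dec (lookup p k ≟M just l))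
        (¬? (toℕ i <? toℕ k ×-dec toℕ k <? toℕ j ×-dec toℕ j <? toℕ l)))))))

allMaybeFin : (n : ℕ) → List (Maybe (Fin n))
allMaybeFin n = nothing ∷ map just (allFin n)

allVecs : {A : Set} → List A → (m : ℕ) → List (Vec A m)
allVecs xs zero = [] ∷ []
allVecs xs (suc m) = concatMap (λ x → map (x ∷_) (allVecs xs m)) xs

allPartnerMaps : (n : ℕ) → List (Vec (Maybe (Fin n)) n)
allPartnerMaps n = allVecs (allMaybeFin n) n

S1 : ℕ → ℕ
S1 n = length (filter isSecStruct1? (allPartnerMaps n))

module Submission where

-- Classifying a structure on n + 2 vertices by the partner of its last vertex (none, or
-- some j < n, which cuts the rest into a structure on [0, j) and one on the n − j vertices
-- under the arc) gives S(n+2) = S(n+1) + Σ_{j<n} S(j) S(n−j), with S(0) = S(1) = 1.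
-- With u(m) = S(m+1), f(1) = 1 and f(k+2) = S(k) this is the renewal equation
-- u(m+1) = Σ_{k≤m} f(k+1) u(m−k). Then u(m+2)² and u(m+1) u(m+3) expand into sums over
-- the same terms, whose weights have increasing ratios f(k+2)/f(k+1) by log-convexity of f
-- and whose terms compare through the increasing ratios of u; so log-convexity of f up to
-- m+1 and of u up to m gives it for u at m+1. As f is a shift of S, one induction
-- proves every inequality.

open import Defs
open import Data.Empty using (⊥-elim)
open import Data.Fin as Fin using (Fin; toℕ; fromℕ<)
open import Data.Fin.Properties using (injective⇒≤; toℕ-injective; toℕ<n; fromℕ<-toℕ; toℕ-fromℕ<)
open import Data.List as List
  using (List; []; _∷_; _++_; length; filter; map; concatMap; allFin; cartesianProductWith; cartesianProduct)
open import Data.List.Properties using (length-++; filter-++; filter-none)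
open import Data.List.Membership.Propositional using (_∈_)
open import Data.List.Membership.Propositional.Properties
  using ( ∈-lookup; ∈-filter⁺; ∈-filter⁻; ∈-map⁺; ∈-map⁻; ∈-allFin
        ; ∈-cartesianProductWith⁺; ∈-cartesianProduct⁺)
open import Data.List.Relation.Unary.All as All using ()
open import Data.List.Relation.Unary.AllPairs using ([]; _∷_)
open import Data.List.Relation.Unary.Any using (here; there; index)
open import Data.List.Relation.Unary.Any.Properties using (lookup-index)
open import Data.List.Relation.Unary.Unique.Propositional using (Unique)
open import Data.List.Relation.Unary.Unique.Propositional.Properties
  using (filter⁺; map⁺; allFin⁺; cartesianProductWith⁺; cartesianProduct⁺)
open import Data.Maybe as Maybe using (Maybe; just; nothing; maybe)
open import Data.Maybe.Properties using (just-injective; map-injective)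
open import Data.Nat
open import Data.Nat.Induction using (<-rec)
open import Data.Nat.Properties
open import Algebra.Properties.CommutativeSemigroup +-commutativeSemigroup using ()
  renaming (interchange to +-interchange)
open import Algebra.Properties.CommutativeSemigroup *-commutativeSemigroup using ()
  renaming (x∙yz≈y∙xz to m*[n*o]≡n*[m*o]; xy∙z≈y∙xz to m*n*o≡n*[m*o])
open import Data.Nat.Tactic.RingSolver using (solve-∀)
open import Data.Product using (_×_; _,_; proj₁; proj₂)
open import Data.Sum using (_⊎_; inj₁; inj₂)
open import Data.Vec using (Vec; []; _∷_; lookup; tabulate)
open import Data.Vec.Properties using (∷-injective; lookup∘tabulate; tabulate∘lookup; tabulate-cong)
open import Function using (_∘_)
open import Relation.Binary.Definitions using (tri<; tri≈; tri>)
open import Relation.Binary.PropositionalEquality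
open import Relation.Nullary using (Dec; yes; no; ¬_; contradiction)
open import Relation.Nullary.Decidable using (_×-dec_)
open import Relation.Unary using (Decidable; _⟨×⟩_)
open import Relation.Unary.Properties using (_∩?_; _×?_)

∑< : ℕ → (ℕ → ℕ) → ℕ
∑< zero    h = 0
∑< (suc n) h = ∑< n h + h n

∑<-cong : ∀ n {g h : ℕ → ℕ} → (∀ k → k < n → g k ≡ h k) → ∑< n g ≡ ∑< n h
∑<-cong zero    eq = refl
∑<-cong (suc n) eq = cong₂ _+_ (∑<-cong n (λ k k<n → eq k (m<n⇒m<1+n k<n))) (eq n ≤-refl)

∑<-mono-≤ : ∀ n {g h : ℕ → ℕ} → (∀ k → k < n → g k ≤ h k) → ∑< n g ≤ ∑< n h
∑<-mono-≤ zero    le = z≤n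
∑<-mono-≤ (suc n) le = +-mono-≤ (∑<-mono-≤ n (λ k k<n → le k (m<n⇒m<1+n k<n))) (le n ≤-refl)

∑<-zero : ∀ n → ∑< n (λ _ → 0) ≡ 0
∑<-zero zero    = refl
∑<-zero (suc n) = trans (+-identityʳ _) (∑<-zero n)

∑<-+ : ∀ n (g h : ℕ → ℕ) → ∑< n (λ k → g k + h k) ≡ ∑< n g + ∑< n h
∑<-+ zero    g h = refl
∑<-+ (suc n) g h = trans (cong (_+ (g n + h n)) (∑<-+ n g h)) (+-interchange (∑< n g) (∑< n h) (g n) (h n))

*-distribˡ-∑< : ∀ c n (h : ℕ → ℕ) → c * ∑< n h ≡ ∑< n (λ k → c * h k)
*-distribˡ-∑< c zero    h = *-zeroʳ c
*-distribˡ-∑< c (suc n) h = trans (*-distribˡ-+ c (∑< n h) (h n)) (cong (_+ c * h n) (*-distribˡ-∑< c n h))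

∑<-suc : ∀ n (h : ℕ → ℕ) → ∑< (suc n) h ≡ h 0 + ∑< n (h ∘ suc)
∑<-suc zero    h = +-comm 0 (h 0)
∑<-suc (suc n) h = trans (cong (_+ h (suc n)) (∑<-suc n h)) (+-assoc (h 0) _ _)

∑<-*-factor : ∀ N (a b : ℕ → ℕ) M → ∑< N (λ k → a k * (M * b k)) ≡ M * ∑< N (λ k → a k * b k)
∑<-*-factor N a b M =
  trans (∑<-cong N (λ k _ → m*[n*o]≡n*[m*o] (a k) M (b k))) (sym (*-distribˡ-∑< M N _))

∑<-suc-∸ : ∀ m (g : ℕ → ℕ → ℕ) →
           ∑< (suc (suc m)) (λ k → g k (suc m ∸ k)) ≡ ∑< (suc m) (λ k → g k (suc (m ∸ k))) + g (suc m) 0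
∑<-suc-∸ m g = cong₂ _+_ (∑<-cong (suc m) (λ k k≤m → cong (g k) (+-∸-assoc 1 (s≤s⁻¹ k≤m))))
                         (cong (g (suc m)) (n∸n≡0 m))

∑<-ratio-≤ : ∀ N {c d Z : ℕ → ℕ} {F G} → (∀ k → k < N → F * d k ≤ G * c k) →
             F * ∑< N (λ k → d k * Z k) ≤ G * ∑< N (λ k → c k * Z k)
∑<-ratio-≤ N {c} {d} {Z} {F} {G} dc = begin
  F * ∑< N (λ k → d k * Z k)   ≡⟨ *-distribˡ-∑< F N _ ⟩
  ∑< N (λ k → F * (d k * Z k)) ≡⟨ ∑<-cong N (λ k _ → sym (*-assoc F (d k) (Z k))) ⟩
  ∑< N (λ k → F * d k * Z k)   ≤⟨ ∑<-mono-≤ N (λ k k<N → *-monoˡ-≤ (Z k) (dc k k<N)) ⟩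
  ∑< N (λ k → G * c k * Z k)   ≡⟨ ∑<-cong N (λ k _ → *-assoc G (c k) (Z k)) ⟩
  ∑< N (λ k → G * (c k * Z k)) ≡⟨ *-distribˡ-∑< G N _ ⟨
  G * ∑< N (λ k → c k * Z k)   ∎
  where open ≤-Reasoning

∑<-split-∸ : ∀ N (c : ℕ → ℕ) {X Y : ℕ → ℕ} → (∀ k → k < N → Y k ≤ X k) →
             ∑< N (λ k → c k * X k) ≡ ∑< N (λ k → c k * Y k) + ∑< N (λ k → c k * (X k ∸ Y k))
∑<-split-∸ N c {X} {Y} Y≤X = begin
  ∑< N (λ k → c k * X k)
    ≡⟨ ∑<-cong N (λ k k<N → cong (c k *_) (m+[n∸m]≡n (Y≤X k k<N))) ⟨
  ∑< N (λ k → c k * (Y k + (X k ∸ Y k)))        ≡⟨ ∑<-cong N (λ k _ → *-distribˡ-+ (c k) (Y k) _) ⟩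
  ∑< N (λ k → c k * Y k + c k * (X k ∸ Y k))    ≡⟨ ∑<-+ N _ _ ⟩
  ∑< N (λ k → c k * Y k) + ∑< N (λ k → c k * (X k ∸ Y k)) ∎
  where open ≡-Reasoning

∑<-excess-≤ : ∀ N (c d : ℕ → ℕ) (F G : ℕ) {X Y : ℕ → ℕ} {W} → 0 < F →
  (∀ k → k < N → Y k ≤ X k) → (∀ k → k < N → F * d k ≤ G * c k) →
  ∑< N (λ k → c k * X k) ≡ ∑< N (λ k → c k * Y k) + F * W →
  ∑< N (λ k → d k * X k) ≤ ∑< N (λ k → d k * Y k) + G * W
∑<-excess-≤ N c d F G {X} {Y} {W} F>0 Y≤X dc cX≡cY+FW =
  *-cancelˡ-≤ F {{>-nonZero F>0}} (begin
    F * ∑< N (λ k → d k * X k)                    ≡⟨ cong (F *_) (∑<-split-∸ N d Y≤X) ⟩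
    F * (∑< N (λ k → d k * Y k) + dZ)             ≡⟨ *-distribˡ-+ F _ dZ ⟩
    F * ∑< N (λ k → d k * Y k) + F * dZ
      ≤⟨ +-monoʳ-≤ (F * ∑< N (λ k → d k * Y k)) (∑<-ratio-≤ N {c} {d} {λ k → X k ∸ Y k} {F} {G} dc) ⟩
    F * ∑< N (λ k → d k * Y k) + G * cZ           ≡⟨ cong (λ t → F * ∑< N (λ k → d k * Y k) + G * t) cZ≡FW ⟩
    F * ∑< N (λ k → d k * Y k) + G * (F * W)      ≡⟨ factor F (∑< N (λ k → d k * Y k)) G W ⟩
    F * (∑< N (λ k → d k * Y k) + G * W)          ∎)
  where
  open ≤-Reasoning
  dZ = ∑< N (λ k → d k * (X k ∸ Y k))
  cZ = ∑< N (λ k → c k * (X k ∸ Y k))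
  cZ≡FW : cZ ≡ F * W
  cZ≡FW = +-cancelˡ-≡ (∑< N (λ k → c k * Y k)) cZ (F * W) (trans (sym (∑<-split-∸ N c Y≤X)) cX≡cY+FW)
  factor : ∀ f s g w → f * s + g * (f * w) ≡ f * (s + g * w)
  factor = solve-∀

-- Log-convex solutions of renewal equations

LogConvexAt : (ℕ → ℕ) → ℕ → Set
LogConvexAt h j = h (suc j) * h (suc j) ≤ h j * h (suc (suc j))

logConvex⇒ratio-mono : (h : ℕ → ℕ) → (∀ k → 0 < h (suc k)) → ∀ {a b} → a ≤ b →
  (∀ j → a ≤ j → j < b → LogConvexAt h j) → h (suc a) * h b ≤ h a * h (suc b)
logConvex⇒ratio-mono h h>0 {a} a≤b lc = go (≤⇒≤′ a≤b) lc
  where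
  go : ∀ {b} → a ≤′ b → (∀ j → a ≤ j → j < b → LogConvexAt h j) → h (suc a) * h b ≤ h a * h (suc b)
  go ≤′-refl _ = ≤-reflexive (*-comm (h (suc a)) (h a))
  go {suc b} (≤′-step a≤′b) lc = *-cancelˡ-≤ (h (suc b)) {{>-nonZero (h>0 b)}} (begin
    h (suc b) * (h (suc a) * h (suc b))   ≡⟨ m*[n*o]≡n*[m*o] (h (suc b)) (h (suc a)) (h (suc b)) ⟩
    h (suc a) * (h (suc b) * h (suc b))   ≤⟨ *-monoʳ-≤ (h (suc a)) (lc b (≤′⇒≤ a≤′b) ≤-refl) ⟩
    h (suc a) * (h b * h (suc (suc b)))   ≡⟨ *-assoc (h (suc a)) (h b) _ ⟨
    h (suc a) * h b * h (suc (suc b))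
      ≤⟨ *-monoˡ-≤ (h (suc (suc b))) (go a≤′b (λ j a≤j j<b → lc j a≤j (m<n⇒m<1+n j<b))) ⟩
    h a * h (suc b) * h (suc (suc b))     ≡⟨ m*n*o≡n*[m*o] (h a) (h (suc b)) (h (suc (suc b))) ⟩
    h (suc b) * (h a * h (suc (suc b)))   ∎)
    where open ≤-Reasoning

module Renewal (u f : ℕ → ℕ)
  (u-rec : ∀ m → u (suc m) ≡ ∑< (suc m) (λ k → f (suc k) * u (m ∸ k)))
  (u>0 : ∀ k → 0 < u k) (f>0 : ∀ k → 0 < f (suc k)) where

  u-rec-first : ∀ m → u (suc (suc m)) ≡ f 1 * u (suc m) + ∑< (suc m) (λ k → f (suc (suc k)) * u (m ∸ k))
  u-rec-first m = trans (u-rec (suc m)) (∑<-suc (suc m) _)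

  u-rec-last : ∀ m → u (suc (suc m)) ≡ ∑< (suc m) (λ k → f (suc k) * u (suc (m ∸ k))) + f (suc (suc m)) * u 0
  u-rec-last m = trans (u-rec (suc m)) (∑<-suc-∸ m (λ k i → f (suc k) * u i))

  u-rec-first-last : ∀ m → u (suc (suc (suc m))) ≡
    f 1 * u (suc (suc m)) + (∑< (suc m) (λ k → f (suc (suc k)) * u (suc (m ∸ k))) + f (suc (suc (suc m))) * u 0)
  u-rec-first-last m =
    trans (u-rec-first (suc m)) (cong (f 1 * u (suc (suc m)) +_) (∑<-suc-∸ m (λ k i → f (suc (suc k)) * u i)))

  logConvexAt-0 : LogConvexAt u 0
  logConvexAt-0 = begin
    u 1 * u 1                              ≡⟨ cong (_* u 1) (u-rec 0) ⟩
    f 1 * u 0 * u 1                        ≡⟨ m*n*o≡n*[m*o] (f 1) (u 0) (u 1) ⟩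
    u 0 * (f 1 * u 1)                      ≤⟨ *-monoʳ-≤ (u 0) (m≤m+n (f 1 * u 1) (f 2 * u 0)) ⟩
    u 0 * (f 1 * u 1 + f 2 * u 0)          ≡⟨ cong (u 0 *_) (u-rec 1) ⟨
    u 0 * u 2                              ∎
    where open ≤-Reasoning

  terms-≤ : ∀ m → (∀ j → j ≤ m → LogConvexAt u j) →
            ∀ k → k < suc m → u (suc m) * u (suc (m ∸ k)) ≤ u (suc (suc m)) * u (m ∸ k)
  terms-≤ m u-lc k _ = begin
    u (suc m) * u (suc (m ∸ k))      ≡⟨ *-comm (u (suc m)) _ ⟩
    u (suc (m ∸ k)) * u (suc m)      ≤⟨ logConvex⇒ratio-mono u (u>0 ∘ suc) (m≤n⇒m≤1+n (m∸n≤m m k))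
                                          (λ j _ j≤m → u-lc j (s≤s⁻¹ j≤m)) ⟩
    u (m ∸ k) * u (suc (suc m))      ≡⟨ *-comm _ (u (suc (suc m))) ⟩
    u (suc (suc m)) * u (m ∸ k)      ∎
    where open ≤-Reasoning

  weights-ratio-≤ : ∀ m → (∀ j → 1 ≤ j → j ≤ suc m → LogConvexAt f j) →
                    ∀ k → k < suc m → f (suc (suc m)) * f (suc (suc k)) ≤ f (suc (suc (suc m))) * f (suc k)
  weights-ratio-≤ m f-lc k (s≤s k≤m) = begin
    f (suc (suc m)) * f (suc (suc k))        ≡⟨ *-comm (f (suc (suc m))) _ ⟩
    f (suc (suc k)) * f (suc (suc m))        ≤⟨ logConvex⇒ratio-mono f f>0 (s≤s (m≤n⇒m≤1+n k≤m))
                                                  (λ j k<j j≤1+m → f-lc j (≤-trans (s≤s z≤n) k<j) (s≤s⁻¹ j≤1+m)) ⟩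
    f (suc k) * f (suc (suc (suc m)))        ≡⟨ *-comm _ (f (suc (suc (suc m)))) ⟩
    f (suc (suc (suc m))) * f (suc k)        ∎
    where open ≤-Reasoning

  -- u(m+2) u(m+1), expanded once through u(m+1) and once through u(m+2).
  product-expansions : ∀ m →
    ∑< (suc m) (λ k → f (suc k) * (u (suc (suc m)) * u (m ∸ k))) ≡
    ∑< (suc m) (λ k → f (suc k) * (u (suc m) * u (suc (m ∸ k)))) + f (suc (suc m)) * (u 0 * u (suc m))
  product-expansions m = begin
    ∑< N (λ k → f (suc k) * (u₂ * u (m ∸ k)))     ≡⟨ ∑<-*-factor N (f ∘ suc) _ u₂ ⟩
    u₂ * ∑< N (λ k → f (suc k) * u (m ∸ k))       ≡⟨ cong (u₂ *_) (u-rec m) ⟨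
    u₂ * u₁                                       ≡⟨ cong (_* u₁) (u-rec-last m) ⟩
    (S + F * u 0) * u₁                            ≡⟨ regroup S F (u 0) u₁ ⟩
    u₁ * S + F * (u 0 * u₁)                       ≡⟨ cong (_+ F * (u 0 * u₁)) (∑<-*-factor N (f ∘ suc) _ u₁) ⟨
    ∑< N (λ k → f (suc k) * (u₁ * u (suc (m ∸ k)))) + F * (u 0 * u₁) ∎
    where
    open ≡-Reasoning
    N = suc m
    u₁ = u (suc m)
    u₂ = u (suc (suc m))
    F = f (suc (suc m))
    S = ∑< N (λ k → f (suc k) * u (suc (m ∸ k)))
    regroup : ∀ s x z y → (s + x * z) * y ≡ y * s + x * (z * y)
    regroup = solve-∀

  logConvexAt-suc : ∀ m → (∀ j → j ≤ m → LogConvexAt u j) →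
                    (∀ j → 1 ≤ j → j ≤ suc m → LogConvexAt f j) → LogConvexAt u (suc m)
  logConvexAt-suc m u-lc f-lc = begin
    u₂ * u₂                                            ≡⟨ cong (u₂ *_) (u-rec-first m) ⟩
    u₂ * (f 1 * u₁ + ∑< N (λ k → d k * u (m ∸ k)))      ≡⟨ *-distribˡ-+ u₂ _ _ ⟩
    u₂ * (f 1 * u₁) + u₂ * ∑< N (λ k → d k * u (m ∸ k))
      ≡⟨ cong (u₂ * (f 1 * u₁) +_) (∑<-*-factor N d _ u₂) ⟨
    u₂ * (f 1 * u₁) + ∑< N (λ k → d k * (u₂ * u (m ∸ k)))
      ≤⟨ +-monoʳ-≤ (u₂ * (f 1 * u₁)) (∑<-excess-≤ N (f ∘ suc) d F G (f>0 (suc m))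
           (terms-≤ m u-lc) (weights-ratio-≤ m f-lc) (product-expansions m)) ⟩
    u₂ * (f 1 * u₁) + (∑< N (λ k → d k * (u₁ * u (suc (m ∸ k)))) + G * (u 0 * u₁))
      ≡⟨ cong (λ t → u₂ * (f 1 * u₁) + (t + G * (u 0 * u₁))) (∑<-*-factor N d _ u₁) ⟩
    u₂ * (f 1 * u₁) + (u₁ * S + G * (u 0 * u₁))        ≡⟨ regroup u₂ (f 1) u₁ S G (u 0) ⟩
    u₁ * (f 1 * u₂ + (S + G * u 0))                    ≡⟨ cong (u₁ *_) (u-rec-first-last m) ⟨
    u₁ * u (suc (suc (suc m)))                         ∎
    where
    open ≤-Reasoning
    N = suc m
    u₁ = u (suc m)
    u₂ = u (suc (suc m))
    d : ℕ → ℕ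
    d k = f (suc (suc k))
    F = f (suc (suc m))
    G = f (suc (suc (suc m)))
    S = ∑< N (λ k → d k * u (suc (m ∸ k)))
    regroup : ∀ x f₁ y s g z → x * (f₁ * y) + (y * s + g * (z * y)) ≡ y * (f₁ * x + (s + g * z))
    regroup = solve-∀

convolution-recurrence⇒logConvex : (a : ℕ → ℕ) → a 0 ≡ 1 → a 1 ≡ 1 →
  (∀ n → a (suc (suc n)) ≡ a (suc n) + ∑< n (λ j → a j * a (n ∸ j))) →
  ∀ n → LogConvexAt a n
convolution-recurrence⇒logConvex a a₀≡1 a₁≡1 a-rec = <-rec (LogConvexAt a) logConvexAt
  where
  a>0 : ∀ n → 0 < a n
  a>0 zero          = subst (0 <_) (sym a₀≡1) z<s
  a>0 (suc zero)    = subst (0 <_) (sym a₁≡1) z<s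
  a>0 (suc (suc n)) = subst (0 <_) (sym (a-rec n)) (≤-trans (a>0 (suc n)) (m≤m+n _ _))

  -- f 0 is junk: the renewal equation only involves f (suc k).
  f : ℕ → ℕ
  f zero          = 0
  f (suc zero)    = 1
  f (suc (suc k)) = a k

  f>0 : ∀ k → 0 < f (suc k)
  f>0 zero    = z<s
  f>0 (suc k) = a>0 k

  u-rec : ∀ m → a (suc (suc m)) ≡ ∑< (suc m) (λ k → f (suc k) * a (suc (m ∸ k)))
  u-rec m = trans (a-rec m) (sym (trans (∑<-suc m _) (cong₂ _+_ (*-identityˡ (a (suc m)))
              (∑<-cong m (λ k k<m → cong (λ i → a k * a i) (sym (+-∸-assoc 1 k<m)))))))

  open Renewal (a ∘ suc) f u-rec (a>0 ∘ suc) f>0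

  logConvexAt : ∀ n → (∀ {i} → i < n → LogConvexAt a i) → LogConvexAt a n
  logConvexAt zero _ = begin
    a 1 * a 1  ≡⟨ cong₂ _*_ a₁≡1 a₁≡1 ⟩
    1          ≤⟨ a>0 2 ⟩
    a 2        ≡⟨ *-identityˡ (a 2) ⟨
    1 * a 2    ≡⟨ cong (_* a 2) a₀≡1 ⟨
    a 0 * a 2  ∎
    where open ≤-Reasoning
  logConvexAt (suc zero) _ = logConvexAt-0
  logConvexAt (suc (suc m)) lc = logConvexAt-suc m (λ j j≤m → lc (s≤s (s≤s j≤m))) f-lc
    where
    f-lc : ∀ j → 1 ≤ j → j ≤ suc m → LogConvexAt f j
    f-lc (suc zero)    _ _         =
      ≤-reflexive (trans (cong₂ _*_ a₀≡1 a₀≡1) (sym (trans (*-identityˡ (a 1)) a₁≡1)))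
    f-lc (suc (suc i)) _ (s≤s i<m) = lc (m<n⇒m<1+n (m<n⇒m<1+n i<m))

private variable
  A B C : Set

count : {P : A → Set} → Decidable P → List A → ℕ
count P? xs = length (filter P? xs)

𝟙 : Dec A → ℕ
𝟙 (yes _) = 1
𝟙 (no _)  = 0

𝟙-×-dec : (a : Dec A) (b : Dec B) → 𝟙 (a ×-dec b) ≡ 𝟙 a * 𝟙 b
𝟙-×-dec (yes _) (yes _) = refl
𝟙-×-dec (yes _) (no _)  = refl
𝟙-×-dec (no _)  _       = refl

∑<-𝟙-≟-0 : ∀ {c} m → m ≤ c → ∑< m (λ t → 𝟙 (c ≟ t)) ≡ 0
∑<-𝟙-≟-0 zero    _ = refl
∑<-𝟙-≟-0 {c} (suc m) m<c with c ≟ m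
... | yes refl = ⊥-elim (<-irrefl refl m<c)
... | no _     = trans (+-identityʳ _) (∑<-𝟙-≟-0 m (<⇒≤ m<c))

∑<-𝟙-≟ : ∀ {c} m → c < m → ∑< m (λ t → 𝟙 (c ≟ t)) ≡ 1
∑<-𝟙-≟ {c} (suc m) c<1+m with c ≟ m
... | yes refl = cong (_+ 1) (∑<-𝟙-≟-0 m ≤-refl)
... | no c≢m   = trans (+-identityʳ _) (∑<-𝟙-≟ m (≤∧≢⇒< (s≤s⁻¹ c<1+m) c≢m))

count-∷ : {P : A → Set} (P? : Decidable P) (x : A) (xs : List A) → count P? (x ∷ xs) ≡ 𝟙 (P? x) + count P? xs
count-∷ P? x xs with P? x
... | yes _ = refl
... | no _  = refl

count-++ : {P : A → Set} (P? : Decidable P) (xs ys : List A) → count P? (xs ++ ys) ≡ count P? xs + count P? ys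
count-++ P? xs ys = trans (cong length (filter-++ P? xs ys)) (length-++ (filter P? xs))

count-none : {P : A → Set} (P? : Decidable P) (xs : List A) → (∀ x → ¬ P x) → count P? xs ≡ 0
count-none P? xs ¬P = cong length (filter-none P? (All.universal ¬P xs))

count-partition : {P : A → Set} (P? : Decidable P) (κ : A → ℕ) (m : ℕ) → (∀ x → κ x < m) →
  ∀ xs → count P? xs ≡ ∑< m (λ t → count (P? ∩? λ x → κ x ≟ t) xs)
count-partition P? κ m κ<m []       = sym (∑<-zero m)
count-partition P? κ m κ<m (x ∷ xs) = begin
  count P? (x ∷ xs)                                                  ≡⟨ count-∷ P? x xs ⟩
  𝟙 (P? x) + count P? xs                                             ≡⟨ cong₂ _+_ 𝟙-partition (count-partition P? κ m κ<m xs) ⟩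
  ∑< m (λ t → 𝟙 (P? x ×-dec κ x ≟ t)) + ∑< m (λ t → count (R? t) xs) ≡⟨ ∑<-+ m _ _ ⟨
  ∑< m (λ t → 𝟙 (P? x ×-dec κ x ≟ t) + count (R? t) xs)               ≡⟨ ∑<-cong m (λ t _ → count-∷ (R? t) x xs) ⟨
  ∑< m (λ t → count (R? t) (x ∷ xs))                                  ∎
  where
  open ≡-Reasoning
  R? : ∀ t → Decidable _
  R? t = P? ∩? λ x → κ x ≟ t
  𝟙-partition : 𝟙 (P? x) ≡ ∑< m (λ t → 𝟙 (P? x ×-dec κ x ≟ t))
  𝟙-partition = begin
    𝟙 (P? x)                                   ≡⟨ *-identityʳ (𝟙 (P? x)) ⟨
    𝟙 (P? x) * 1                               ≡⟨ cong (𝟙 (P? x) *_) (∑<-𝟙-≟ m (κ<m x)) ⟨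
    𝟙 (P? x) * ∑< m (λ t → 𝟙 (κ x ≟ t))        ≡⟨ *-distribˡ-∑< (𝟙 (P? x)) m _ ⟩
    ∑< m (λ t → 𝟙 (P? x) * 𝟙 (κ x ≟ t))        ≡⟨ ∑<-cong m (λ t _ → 𝟙-×-dec (P? x) (κ x ≟ t)) ⟨
    ∑< m (λ t → 𝟙 (P? x ×-dec κ x ≟ t))        ∎

count-map-, : {P : A → Set} {Q : B → Set} (P? : Decidable P) (Q? : Decidable Q) (x : A) (ys : List B) →
  count (P? ×? Q?) (map (x ,_) ys) ≡ 𝟙 (P? x) * count Q? ys
count-map-, P? Q? x []       = sym (*-zeroʳ (𝟙 (P? x)))
count-map-, P? Q? x (y ∷ ys) = begin
  count (P? ×? Q?) ((x , y) ∷ map (x ,_) ys)    ≡⟨ count-∷ (P? ×? Q?) (x , y) _ ⟩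
  𝟙 (P? x ×-dec Q? y) + count (P? ×? Q?) (map (x ,_) ys)
                                                ≡⟨ cong₂ _+_ (𝟙-×-dec (P? x) (Q? y)) (count-map-, P? Q? x ys) ⟩
  𝟙 (P? x) * 𝟙 (Q? y) + 𝟙 (P? x) * count Q? ys  ≡⟨ *-distribˡ-+ (𝟙 (P? x)) _ _ ⟨
  𝟙 (P? x) * (𝟙 (Q? y) + count Q? ys)           ≡⟨ cong (𝟙 (P? x) *_) (count-∷ Q? y ys) ⟨
  𝟙 (P? x) * count Q? (y ∷ ys)                  ∎
  where open ≡-Reasoning

count-cartesianProduct : {P : A → Set} {Q : B → Set} (P? : Decidable P) (Q? : Decidable Q) (xs : List A) (ys : List B) →
  count (P? ×? Q?) (cartesianProduct xs ys) ≡ count P? xs * count Q? ys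
count-cartesianProduct P? Q? []       ys = refl
count-cartesianProduct P? Q? (x ∷ xs) ys = begin
  count (P? ×? Q?) (map (x ,_) ys ++ cartesianProduct xs ys)        ≡⟨ count-++ (P? ×? Q?) (map (x ,_) ys) _ ⟩
  count (P? ×? Q?) (map (x ,_) ys) + count (P? ×? Q?) (cartesianProduct xs ys)
                                       ≡⟨ cong₂ _+_ (count-map-, P? Q? x ys) (count-cartesianProduct P? Q? xs ys) ⟩
  𝟙 (P? x) * count Q? ys + count P? xs * count Q? ys                ≡⟨ *-distribʳ-+ (count Q? ys) (𝟙 (P? x)) _ ⟨
  (𝟙 (P? x) + count P? xs) * count Q? ys                           ≡⟨ cong (_* count Q? ys) (count-∷ P? x xs) ⟨
  count P? (x ∷ xs) * count Q? ys                                  ∎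
  where open ≡-Reasoning

record Enumerates (xs : List A) : Set where
  field
    unique   : Unique xs
    complete : ∀ x → x ∈ xs

record Bijection (P : A → Set) (Q : B → Set) : Set where
  field
    to        : A → B
    from      : B → A
    to-resp   : ∀ {x} → P x → Q (to x)
    from-resp : ∀ {y} → Q y → P (from y)
    from∘to   : ∀ {x} → P x → from (to x) ≡ x
    to∘from   : ∀ {y} → Q y → to (from y) ≡ y

lookup-injective : {xs : List A} → Unique xs → ∀ {i j} → List.lookup xs i ≡ List.lookup xs j → i ≡ j
lookup-injective (_ ∷ u) {Fin.zero}  {Fin.zero}  _  = refl
lookup-injective (x∉ ∷ _) {Fin.zero}  {Fin.suc j} eq = ⊥-elim (All.lookup x∉ (∈-lookup j) eq)
lookup-injective (x∉ ∷ _) {Fin.suc i} {Fin.zero}  eq = ⊥-elim (All.lookup x∉ (∈-lookup i) (sym eq))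
lookup-injective (_ ∷ u) {Fin.suc i} {Fin.suc j} eq = cong Fin.suc (lookup-injective u eq)

count-≤-injection : {P : A → Set} {Q : B → Set} (P? : Decidable P) (Q? : Decidable Q) {xs : List A} {ys : List B} →
  Unique xs → (∀ y → y ∈ ys) → (f : A → B) → (∀ {x} → P x → Q (f x)) →
  (∀ {x x′} → P x → P x′ → f x ≡ f x′ → x ≡ x′) → count P? xs ≤ count Q? ys
count-≤-injection {P = P} P? Q? {xs} {ys} xs-unique ys-complete f f-resp f-inj = injective⇒≤ index-injective
  where
  P-lookup : ∀ i → P (List.lookup (filter P? xs) i)
  P-lookup i = proj₂ (∈-filter⁻ P? {xs = xs} (∈-lookup i))
  f-lookup∈ : ∀ i → f (List.lookup (filter P? xs) i) ∈ filter Q? ys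
  f-lookup∈ i = ∈-filter⁺ Q? (ys-complete _) (f-resp (P-lookup i))
  index-injective : ∀ {i j} → index (f-lookup∈ i) ≡ index (f-lookup∈ j) → i ≡ j
  index-injective {i} {j} eq = lookup-injective (filter⁺ P? xs-unique)
    (f-inj (P-lookup i) (P-lookup j)
      (trans (lookup-index (f-lookup∈ i)) (trans (cong (List.lookup (filter Q? ys)) eq) (sym (lookup-index (f-lookup∈ j))))))

count-bijection : {P : A → Set} {Q : B → Set} (P? : Decidable P) (Q? : Decidable Q) {xs : List A} {ys : List B} →
  Enumerates xs → Enumerates ys → Bijection P Q → count P? xs ≡ count Q? ys
count-bijection P? Q? exs eys bij = ≤-antisym
  (count-≤-injection P? Q? (unique exs) (complete eys) to to-resp
    (λ px px′ eq → trans (sym (from∘to px)) (trans (cong from eq) (from∘to px′))))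
  (count-≤-injection Q? P? (unique eys) (complete exs) from from-resp
    (λ qy qy′ eq → trans (sym (to∘from qy)) (trans (cong to eq) (to∘from qy′))))
  where
  open Enumerates
  open Bijection bij

enumerates-cartesianProduct : {xs : List A} {ys : List B} →
  Enumerates xs → Enumerates ys → Enumerates (cartesianProduct xs ys)
enumerates-cartesianProduct exs eys = record
  { unique   = cartesianProduct⁺ (unique exs) (unique eys)
  ; complete = λ (x , y) → ∈-cartesianProduct⁺ (complete exs x) (complete eys y) }
  where open Enumerates

concatMap-map≡cartesianProductWith : (f : A → B → C) (xs : List A) (ys : List B) →
  concatMap (λ x → map (f x) ys) xs ≡ cartesianProductWith f xs ys
concatMap-map≡cartesianProductWith f []       ys = refl
concatMap-map≡cartesianProductWith f (x ∷ xs) ys = cong (map (f x) ys ++_) (concatMap-map≡cartesianProductWith f xs ys)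

allVecs-enumerates : {xs : List A} → Enumerates xs → ∀ m → Enumerates (allVecs xs m)
allVecs-enumerates exs zero    = record { unique = All.[] ∷ [] ; complete = λ { [] → here refl } }
allVecs-enumerates {xs = xs} exs (suc m) = record
  { unique   = subst Unique (sym cp) (cartesianProductWith⁺ _∷_ ∷-injective (unique exs) (unique evs))
  ; complete = λ { (x ∷ v) →
      subst (x ∷ v ∈_) (sym cp) (∈-cartesianProductWith⁺ _∷_ (complete exs x) (complete evs v)) } }
  where
  open Enumerates
  evs = allVecs-enumerates exs m
  cp = concatMap-map≡cartesianProductWith _∷_ xs (allVecs xs m)

allMaybeFin-enumerates : ∀ n → Enumerates (allMaybeFin n)
allMaybeFin-enumerates n = record
  { unique   = All.tabulate nothing∉ ∷ map⁺ just-injective (allFin⁺ n)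
  ; complete = λ { nothing → here refl ; (just i) → there (∈-map⁺ just (∈-allFin i)) } }
  where
  nothing∉ : ∀ {y} → y ∈ map just (allFin n) → nothing ≢ y
  nothing∉ y∈ with ∈-map⁻ just y∈
  ... | _ , _ , refl = λ ()

allPartnerMaps-enumerates : ∀ n → Enumerates (allPartnerMaps n)
allPartnerMaps-enumerates n = allVecs-enumerates (allMaybeFin-enumerates n) n

PartnerMap : ℕ → Set
PartnerMap n = Vec (Maybe (Fin n)) n

-- On partial functions ℕ → Maybe ℕ, restricting, shifting and gluing structures is plain index arithmetic.
PartnerFn : Set
PartnerFn = ℕ → Maybe ℕ

Bounded : ℕ → PartnerFn → Set
Bounded n π = ∀ {i j} → π i ≡ just j → i < n × j < n

Bounded⇒≡nothing : ∀ {n π i} → Bounded n π → n ≤ i → π i ≡ nothing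
Bounded⇒≡nothing {π = π} {i} π-bounded n≤i with π i in eq
... | nothing = refl
... | just _  = contradiction (proj₁ (π-bounded eq)) (≤⇒≯ n≤i)

record IsStructure (n : ℕ) (π : PartnerFn) : Set where
  field
    bounded     : Bounded n π
    symmetric   : ∀ {i j} → π i ≡ just j → π j ≡ just i
    long        : ∀ {i j} → π i ≡ just j → suc i < j ⊎ suc j < i
    noncrossing : ∀ {i j k l} → i < j → π i ≡ just j → k < l → π k ≡ just l →
                  ¬ (i < k × k < j × j < l)

isStructure-resp : ∀ {n} {π π′ : PartnerFn} → π ≗ π′ → IsStructure n π → IsStructure n π′
isStructure-resp {π = π} {π′} π≗π′ s = record
  { bounded     = bounded ∘ from
  ; symmetric   = λ e → trans (sym (π≗π′ _)) (symmetric (from e))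
  ; long        = long ∘ from
  ; noncrossing = λ i<j e k<l e′ → noncrossing i<j (from e) k<l (from e′) }
  where
  open IsStructure s
  from : ∀ {i j} → π′ i ≡ just j → π i ≡ just j
  from = trans (π≗π′ _)

isStructure-weaken : ∀ {n π} → IsStructure n π → IsStructure (suc n) π
isStructure-weaken s = record
  { bounded = λ e → let i<n , j<n = bounded e in m<n⇒m<1+n i<n , m<n⇒m<1+n j<n
  ; symmetric = symmetric ; long = long ; noncrossing = noncrossing }
  where open IsStructure s

isStructure-shrink : ∀ {n π} → IsStructure (suc n) π → π n ≡ nothing → IsStructure n π
isStructure-shrink {n} {π} s πn≡nothing = record
  { bounded = bounded′ ; symmetric = symmetric ; long = long ; noncrossing = noncrossing }
  where
  open IsStructure s
  ≢n : ∀ {i j} → π i ≡ just j → i ≢ n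
  ≢n e refl with () ← trans (sym πn≡nothing) e
  bounded′ : Bounded n π
  bounded′ e = let i<1+n , j<1+n = bounded e in
    ≤∧≢⇒< (s≤s⁻¹ i<1+n) (≢n e) , ≤∧≢⇒< (s≤s⁻¹ j<1+n) (≢n (symmetric e))

⟦_⟧ : ∀ {n} → PartnerMap n → PartnerFn
⟦_⟧ {n} p i with i <? n
... | yes i<n = Maybe.map toℕ (lookup p (fromℕ< i<n))
... | no _    = nothing

⟦⟧-toℕ : ∀ {n} (p : PartnerMap n) (i : Fin n) → ⟦ p ⟧ (toℕ i) ≡ Maybe.map toℕ (lookup p i)
⟦⟧-toℕ {n} p i with toℕ i <? n
... | yes i<n = cong (Maybe.map toℕ ∘ lookup p) (fromℕ<-toℕ i i<n)
... | no  i≮n = contradiction (toℕ<n i) i≮n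

data Paired {n} (p : PartnerMap n) : ℕ → ℕ → Set where
  paired : ∀ {i j} → lookup p i ≡ just j → Paired p (toℕ i) (toℕ j)

⟦⟧-paired : ∀ {n} (p : PartnerMap n) {i j} → ⟦ p ⟧ i ≡ just j → Paired p i j
⟦⟧-paired {n} p {i} e with i <? n
... | yes i<n with lookup p (fromℕ< i<n) in eq | e
...   | just j | refl = subst (λ k → Paired p k (toℕ j)) (toℕ-fromℕ< i<n) (paired eq)

⟦⟧-just : ∀ {n} (p : PartnerMap n) {i j} → lookup p i ≡ just j → ⟦ p ⟧ (toℕ i) ≡ just (toℕ j)
⟦⟧-just p {i} e = trans (⟦⟧-toℕ p i) (cong (Maybe.map toℕ) e)

⟦⟧-bounded : ∀ {n} (p : PartnerMap n) → Bounded n ⟦ p ⟧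
⟦⟧-bounded p e with ⟦⟧-paired p e
... | paired {i} {j} _ = toℕ<n i , toℕ<n j

isSecStruct1⇒isStructure : ∀ {n} (p : PartnerMap n) → IsSecStruct1 p → IsStructure n ⟦ p ⟧
isSecStruct1⇒isStructure p (sym-p , long-p , nc-p) = record
  { bounded     = ⟦⟧-bounded p
  ; symmetric   = symmetric
  ; long        = long
  ; noncrossing = noncrossing }
  where
  symmetric : ∀ {i j} → ⟦ p ⟧ i ≡ just j → ⟦ p ⟧ j ≡ just i
  symmetric e with ⟦⟧-paired p e
  ... | paired e′ = ⟦⟧-just p (sym-p _ _ e′)
  long : ∀ {i j} → ⟦ p ⟧ i ≡ just j → suc i < j ⊎ suc j < i
  long e with ⟦⟧-paired p e
  ... | paired e′ = long-p _ _ e′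
  noncrossing : ∀ {i j k l} → i < j → ⟦ p ⟧ i ≡ just j → k < l → ⟦ p ⟧ k ≡ just l →
                ¬ (i < k × k < j × j < l)
  noncrossing i<j e k<l e′ with ⟦⟧-paired p e | ⟦⟧-paired p e′
  ... | paired f | paired f′ = nc-p _ _ _ _ (i<j , f) (k<l , f′)

isStructure⇒isSecStruct1 : ∀ {n} {p : PartnerMap n} → IsStructure n ⟦ p ⟧ → IsSecStruct1 p
isStructure⇒isSecStruct1 {p = p} s =
  symmetric′ , (λ i j e → long (⟦⟧-just p e)) ,
  (λ i j k l (i<j , e) (k<l , e′) → noncrossing i<j (⟦⟧-just p e) k<l (⟦⟧-just p e′))
  where
  open IsStructure s
  symmetric′ : Symmetric p
  symmetric′ i j e with lookup p j in eq | trans (sym (⟦⟧-toℕ p j)) (symmetric (⟦⟧-just p e))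
  ... | just i′ | eq′ = cong just (toℕ-injective (just-injective eq′))

toMaybeFin : ∀ n → Maybe ℕ → Maybe (Fin n)
toMaybeFin n nothing = nothing
toMaybeFin n (just v) with v <? n
... | yes v<n = just (fromℕ< v<n)
... | no _    = nothing

toPartnerMap : ∀ n → PartnerFn → PartnerMap n
toPartnerMap n π = tabulate (toMaybeFin n ∘ π ∘ toℕ)

toℕ-toMaybeFin : ∀ {n} (m : Maybe ℕ) → (∀ {v} → m ≡ just v → v < n) → Maybe.map toℕ (toMaybeFin n m) ≡ m
toℕ-toMaybeFin nothing _ = refl
toℕ-toMaybeFin {n} (just v) m<n with v <? n
... | yes v<n = cong just (toℕ-fromℕ< v<n)
... | no  v≮n = contradiction (m<n refl) v≮n

⟦toPartnerMap⟧ : ∀ n {π} → Bounded n π → ⟦ toPartnerMap n π ⟧ ≗ π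
⟦toPartnerMap⟧ n {π} π-bounded i with i <? n
... | yes i<n = begin
  Maybe.map toℕ (lookup (toPartnerMap n π) (fromℕ< i<n))
    ≡⟨ cong (Maybe.map toℕ) (lookup∘tabulate _ (fromℕ< i<n)) ⟩
  Maybe.map toℕ (toMaybeFin n (π (toℕ (fromℕ< i<n))))
    ≡⟨ cong (Maybe.map toℕ ∘ toMaybeFin n ∘ π) (toℕ-fromℕ< i<n) ⟩
  Maybe.map toℕ (toMaybeFin n (π i))                       ≡⟨ toℕ-toMaybeFin (π i) (proj₂ ∘ π-bounded) ⟩
  π i                                                      ∎
  where open ≡-Reasoning
... | no i≮n = sym (Bounded⇒≡nothing π-bounded (≮⇒≥ i≮n))

⟦⟧-injective : ∀ {n} {p q : PartnerMap n} → ⟦ p ⟧ ≗ ⟦ q ⟧ → p ≡ q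
⟦⟧-injective {p = p} {q} eq = trans (sym (tabulate∘lookup p)) (trans (tabulate-cong lookup-eq) (tabulate∘lookup q))
  where
  lookup-eq : ∀ i → lookup p i ≡ lookup q i
  lookup-eq i = map-injective toℕ-injective (trans (sym (⟦⟧-toℕ p i)) (trans (eq (toℕ i)) (⟦⟧-toℕ q i)))

toPartnerMap-⟦⟧ : ∀ {n} (q : PartnerMap n) {π} → π ≗ ⟦ q ⟧ → toPartnerMap n π ≡ q
toPartnerMap-⟦⟧ {n} q {π} π≗q = ⟦⟧-injective (λ i → trans (⟦toPartnerMap⟧ n π-bounded i) (π≗q i))
  where
  π-bounded : Bounded n π
  π-bounded e = ⟦⟧-bounded q (trans (sym (π≗q _)) e)

toPartnerMap-isSecStruct1 : ∀ {n π} → IsStructure n π → IsSecStruct1 (toPartnerMap n π)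
toPartnerMap-isSecStruct1 {n} s =
  isStructure⇒isSecStruct1 (isStructure-resp (sym ∘ ⟦toPartnerMap⟧ n (IsStructure.bounded s)) s)

-- Splitting at the partner of the last vertex

guard : {P : Set} → Dec P → Maybe A → Maybe A
guard (yes _) m = m
guard (no _)  _ = nothing

guard-yes : {P : Set} → P → (d : Dec P) (m : Maybe A) → guard d m ≡ m
guard-yes p (yes _) m = refl
guard-yes p (no ¬p) m = contradiction p ¬p

guard-just : {P : Set} (d : Dec P) (m : Maybe A) {v : A} → guard d m ≡ just v → P × m ≡ just v
guard-just (yes p) m e = p , e

restrict : ℕ → PartnerFn → PartnerFn
restrict j π i = guard (i <? j) (π i)

shiftDown : ℕ → ℕ → PartnerFn → PartnerFn
shiftDown s k π i = guard (i <? k) (Maybe.map (_∸ s) (π (i + s)))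

-- The structure on [0, n+2) made of π₁ on [0, j), the arc {j, n+1}, and π₂ moved to (j, n+1).
glue : ℕ → ℕ → PartnerFn → PartnerFn → PartnerFn
glue j n π₁ π₂ i with <-cmp i j | <-cmp i (suc n)
... | tri< _ _ _ | _          = π₁ i
... | tri≈ _ _ _ | _          = just (suc n)
... | tri> _ _ _ | tri< _ _ _ = Maybe.map (_+ suc j) (π₂ (i ∸ suc j))
... | tri> _ _ _ | tri≈ _ _ _ = just j
... | tri> _ _ _ | tri> _ _ _ = nothing

restrict-cong : ∀ j {π π′} → π ≗ π′ → restrict j π ≗ restrict j π′
restrict-cong j eq i = cong (guard (i <? j)) (eq i)

shiftDown-cong : ∀ s k {π π′} → π ≗ π′ → shiftDown s k π ≗ shiftDown s k π′
shiftDown-cong s k eq i = cong (guard (i <? k) ∘ Maybe.map (_∸ s)) (eq (i + s))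

glue-cong : ∀ j n {π₁ π₁′ π₂ π₂′} → π₁ ≗ π₁′ → π₂ ≗ π₂′ → glue j n π₁ π₂ ≗ glue j n π₁′ π₂′
glue-cong j n eq₁ eq₂ i with <-cmp i j | <-cmp i (suc n)
... | tri< _ _ _ | _          = eq₁ i
... | tri≈ _ _ _ | _          = refl
... | tri> _ _ _ | tri< _ _ _ = cong (Maybe.map (_+ suc j)) (eq₂ (i ∸ suc j))
... | tri> _ _ _ | tri≈ _ _ _ = refl
... | tri> _ _ _ | tri> _ _ _ = refl

∸+suc≡suc : ∀ {j n} → j ≤ n → n ∸ j + suc j ≡ suc n
∸+suc≡suc {j} j≤n = trans (+-suc _ j) (cong suc (m∸n+n≡m j≤n))

<∸⇒+suc<suc : ∀ {i j n} → j ≤ n → i < n ∸ j → i + suc j < suc n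
<∸⇒+suc<suc {i} {j} j≤n i<n∸j = subst (i + suc j <_) (∸+suc≡suc j≤n) (+-monoˡ-< (suc j) i<n∸j)

+suc<suc⇒<∸ : ∀ {i j n} → j ≤ n → i + suc j < suc n → i < n ∸ j
+suc<suc⇒<∸ {i} {j} {n} j≤n lt = +-cancelʳ-< (suc j) i (n ∸ j) (subst (i + suc j <_) (sym (∸+suc≡suc j≤n)) lt)

module Split (n j : ℕ) (j<n : j < n) (π : PartnerFn)
             (π-struct : IsStructure (suc (suc n)) π) (π-last : π (suc n) ≡ just j) where

  open IsStructure π-struct

  private
    s = suc j
    k = n ∸ j
    j≤n = <⇒≤ j<n
    j<1+n = m<n⇒m<1+n j<n
    π-j = symmetric π-last

  partner-inside : ∀ {x y} → j < x → x < suc n → π x ≡ just y → j < y × y < suc n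
  partner-inside {x} {y} j<x x<1+n e with <-cmp y j
  ... | tri< y<j _ _ = contradiction (y<j , j<x , x<1+n) (noncrossing (<-trans y<j j<x) (symmetric e) j<1+n π-j)
  ... | tri≈ _ refl _ = contradiction (just-injective (trans (sym (symmetric e)) π-j)) (<⇒≢ x<1+n)
  ... | tri> _ _ j<y with <-cmp y (suc n)
  ...   | tri< y<1+n _ _ = j<y , y<1+n
  ...   | tri≈ _ refl _ = contradiction (just-injective (trans (sym π-last) (symmetric e))) (<⇒≢ j<x)
  ...   | tri> _ _ 1+n<y = contradiction (j<x , x<1+n , 1+n<y) (noncrossing j<1+n π-j (<-trans x<1+n 1+n<y) e)

  partner-left : ∀ {x y} → x < j → π x ≡ just y → y < j
  partner-left {x} {y} x<j e with <-cmp y j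
  ... | tri< y<j _ _ = y<j
  ... | tri≈ _ refl _ = contradiction (just-injective (trans (sym (symmetric e)) π-j)) (<⇒≢ (<-trans x<j j<1+n))
  ... | tri> _ _ j<y with <-cmp y (suc n)
  ...   | tri< y<1+n _ _ = contradiction x<j (<-asym (proj₁ (partner-inside j<y y<1+n (symmetric e))))
  ...   | tri≈ _ refl _ = contradiction (just-injective (trans (sym π-last) (symmetric e))) (<⇒≢ x<j ∘ sym)
  ...   | tri> _ _ 1+n<y = contradiction (proj₂ (bounded e)) (<⇒≱ (s≤s 1+n<y))

  restrict-isStructure : IsStructure j (restrict j π)
  restrict-isStructure = record
    { bounded     = λ e → let i<j , e′ = restrict-just e in i<j , partner-left i<j e′
    ; symmetric   = λ e → let i<j , e′ = restrict-just e in
                          trans (guard-yes (partner-left i<j e′) _ _) (symmetric e′)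
    ; long        = long ∘ proj₂ ∘ restrict-just
    ; noncrossing = λ i<j e k<l e′ → noncrossing i<j (proj₂ (restrict-just e)) k<l (proj₂ (restrict-just e′)) }
    where
    restrict-just : ∀ {i v} → restrict j π i ≡ just v → i < j × π i ≡ just v
    restrict-just {i} = guard-just (i <? j) (π i)

  shiftDown-just : ∀ {i w} → shiftDown s k π i ≡ just w → i < k × w < k × π (i + s) ≡ just (w + s)
  shiftDown-just {i} e with guard-just (i <? k) _ e
  ... | i<k , e′ with π (i + s) in eq | e′
  ...   | just v | refl =
    let j<v , v<1+n = partner-inside (m≤n+m s i) (<∸⇒+suc<suc j≤n i<k) eq
        v∸s+s≡v     = m∸n+n≡m j<v
    in i<k , +suc<suc⇒<∸ j≤n (subst (_< suc n) (sym v∸s+s≡v) v<1+n) , cong just (sym v∸s+s≡v)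

  shiftDown-intro : ∀ {i w} → i < k → π (i + s) ≡ just (w + s) → shiftDown s k π i ≡ just w
  shiftDown-intro {i} {w} i<k e = trans (guard-yes i<k _ _) (trans (cong (Maybe.map (_∸ s)) e) (cong just (m+n∸n≡m w s)))

  shiftDown-isStructure : IsStructure k (shiftDown s k π)
  shiftDown-isStructure = record
    { bounded     = λ e → let i<k , w<k , _ = shiftDown-just e in i<k , w<k
    ; symmetric   = λ e → let _ , w<k , e′ = shiftDown-just e in shiftDown-intro w<k (symmetric e′)
    ; long        = long′
    ; noncrossing = noncrossing′ }
    where
    long′ : ∀ {i w} → shiftDown s k π i ≡ just w → suc i < w ⊎ suc w < i
    long′ {i} {w} e with long (proj₂ (proj₂ (shiftDown-just e)))
    ... | inj₁ lt = inj₁ (+-cancelʳ-< s (suc i) w lt)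
    ... | inj₂ lt = inj₂ (+-cancelʳ-< s (suc w) i lt)
    noncrossing′ : ∀ {a b c d} → a < b → shiftDown s k π a ≡ just b → c < d → shiftDown s k π c ≡ just d →
                   ¬ (a < c × c < b × b < d)
    noncrossing′ a<b e c<d e′ (a<c , c<b , b<d) =
      noncrossing (+-monoˡ-< s a<b) (proj₂ (proj₂ (shiftDown-just e)))
                  (+-monoˡ-< s c<d) (proj₂ (proj₂ (shiftDown-just e′)))
                  (+-monoˡ-< s a<c , +-monoˡ-< s c<b , +-monoˡ-< s b<d)

  glue-restrict-shiftDown : glue j n (restrict j π) (shiftDown s k π) ≗ π
  glue-restrict-shiftDown i with <-cmp i j | <-cmp i (suc n)
  ... | tri< i<j _ _ | _          = guard-yes i<j _ _
  ... | tri≈ _ refl _ | _         = sym π-j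
  ... | tri> _ _ j<i | tri< i<1+n _ _ = begin
    Maybe.map (_+ s) (shiftDown s k π (i ∸ s))
      ≡⟨ cong (Maybe.map (_+ s)) (guard-yes (+suc<suc⇒<∸ j≤n i∸s+s<1+n) (i ∸ s <? k) _) ⟩
    Maybe.map (_+ s) (Maybe.map (_∸ s) (π (i ∸ s + s)))
      ≡⟨ cong (Maybe.map (_+ s) ∘ Maybe.map (_∸ s) ∘ π) i∸s+s≡i ⟩
    Maybe.map (_+ s) (Maybe.map (_∸ s) (π i))              ≡⟨ shift-back ⟩
    π i                                                    ∎
    where
    open ≡-Reasoning
    i∸s+s≡i : i ∸ s + s ≡ i
    i∸s+s≡i = m∸n+n≡m j<i
    i∸s+s<1+n : i ∸ s + s < suc n
    i∸s+s<1+n = subst (_< suc n) (sym i∸s+s≡i) i<1+n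
    shift-back : Maybe.map (_+ s) (Maybe.map (_∸ s) (π i)) ≡ π i
    shift-back with π i in eq
    ... | nothing = refl
    ... | just v  = cong just (m∸n+n≡m (proj₁ (partner-inside j<i i<1+n eq)))
  ... | tri> _ _ _ | tri≈ _ refl _ = sym π-last
  ... | tri> _ _ _ | tri> _ _ 1+n<i = sym (Bounded⇒≡nothing bounded 1+n<i)

module Glue (n j : ℕ) (j<n : j < n) (π₁ π₂ : PartnerFn)
            (π₁-struct : IsStructure j π₁) (π₂-struct : IsStructure (n ∸ j) π₂) where

  private
    s = suc j
    k = n ∸ j
    j≤n = <⇒≤ j<n
    γ = glue j n π₁ π₂
    j<1+n = m<n⇒m<1+n j<n
    module S₁ = IsStructure π₁-struct
    module S₂ = IsStructure π₂-struct

  data GlueArc : ℕ → ℕ → Set where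
    left   : ∀ {i v} → π₁ i ≡ just v → GlueArc i v
    outer  : GlueArc j (suc n)
    inner  : ∀ {i v} → π₂ i ≡ just v → GlueArc (i + s) (v + s)
    outer′ : GlueArc (suc n) j

  glue-arc : ∀ {i v} → γ i ≡ just v → GlueArc i v
  glue-arc {i} e with <-cmp i j | <-cmp i (suc n)
  ... | tri< _ _ _  | _           = left e
  ... | tri≈ _ refl _ | _         with refl ← e = outer
  ... | tri> _ _ j<i | tri< _ _ _ with π₂ (i ∸ s) in eq | e
  ...   | just w | refl = subst (λ x → GlueArc x (w + s)) (m∸n+n≡m j<i) (inner eq)
  glue-arc e | tri> _ _ _ | tri≈ _ refl _ with refl ← e = outer′

  glue-left : ∀ {i} → i < j → γ i ≡ π₁ i
  glue-left {i} i<j with <-cmp i j | <-cmp i (suc n)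
  ... | tri< _ _ _    | _ = refl
  ... | tri≈ i≮j _ _  | _ = contradiction i<j i≮j
  ... | tri> i≮j _ _  | _ = contradiction i<j i≮j

  glue-at-j : γ j ≡ just (suc n)
  glue-at-j with <-cmp j j | <-cmp j (suc n)
  ... | tri≈ _ _ _   | _ = refl
  ... | tri< _ j≢j _ | _ = contradiction refl j≢j
  ... | tri> _ j≢j _ | _ = contradiction refl j≢j

  glue-inner : ∀ {i} → i < k → γ (i + s) ≡ Maybe.map (_+ s) (π₂ i)
  glue-inner {i} i<k with <-cmp (i + s) j | <-cmp (i + s) (suc n)
  ... | tri> _ _ _ | tri< _ _ _      = cong (Maybe.map (_+ s) ∘ π₂) (m+n∸n≡m i s)
  ... | tri< i+s<j _ _ | _           = contradiction (m≤n+m s i) (<⇒≱ (m<n⇒m<1+n i+s<j))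
  ... | tri≈ _ i+s≡j _ | _           = contradiction (subst (s ≤_) i+s≡j (m≤n+m s i)) (<-irrefl refl)
  ... | tri> _ _ _ | tri≈ i+s≮1+n _ _ = contradiction (<∸⇒+suc<suc j≤n i<k) i+s≮1+n
  ... | tri> _ _ _ | tri> i+s≮1+n _ _ = contradiction (<∸⇒+suc<suc j≤n i<k) i+s≮1+n

  glue-last : γ (suc n) ≡ just j
  glue-last with <-cmp (suc n) j | <-cmp (suc n) (suc n)
  ... | tri> _ _ _ | tri≈ _ _ _        = refl
  ... | tri< 1+n<j _ _ | _             = contradiction j<1+n (<-asym 1+n<j)
  ... | tri≈ _ 1+n≡j _ | _             = contradiction (sym 1+n≡j) (<⇒≢ j<1+n)
  ... | tri> _ _ _ | tri< _ 1+n≢1+n _  = contradiction refl 1+n≢1+n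
  ... | tri> _ _ _ | tri> _ 1+n≢1+n _  = contradiction refl 1+n≢1+n

  glue-isStructure : IsStructure (suc (suc n)) γ
  glue-isStructure = record
    { bounded = bounded ; symmetric = symmetric ; long = long ; noncrossing = noncrossing }
    where
    bounded : Bounded (suc (suc n)) γ
    bounded e with glue-arc e
    ... | left e′  = let i<j , v<j = S₁.bounded e′ in
                     <-trans i<j (m<n⇒m<1+n j<1+n) , <-trans v<j (m<n⇒m<1+n j<1+n)
    ... | outer    = m<n⇒m<1+n j<1+n , ≤-refl
    ... | inner e′ = let i<k , v<k = S₂.bounded e′ in
                     m<n⇒m<1+n (<∸⇒+suc<suc j≤n i<k) , m<n⇒m<1+n (<∸⇒+suc<suc j≤n v<k)
    ... | outer′   = ≤-refl , m<n⇒m<1+n j<1+n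
    symmetric : ∀ {i v} → γ i ≡ just v → γ v ≡ just i
    symmetric e with glue-arc e
    ... | left e′  = trans (glue-left (proj₂ (S₁.bounded e′))) (S₁.symmetric e′)
    ... | outer    = glue-last
    ... | inner e′ = trans (glue-inner (proj₂ (S₂.bounded e′))) (cong (Maybe.map (_+ s)) (S₂.symmetric e′))
    ... | outer′   = glue-at-j
    long : ∀ {i v} → γ i ≡ just v → suc i < v ⊎ suc v < i
    long e with glue-arc e
    ... | left e′  = S₁.long e′
    ... | outer    = inj₁ (s<s j<n)
    ... | inner e′ with S₂.long e′
    ...   | inj₁ lt = inj₁ (+-monoˡ-< s lt)
    ...   | inj₂ lt = inj₂ (+-monoˡ-< s lt)
    long e | outer′ = inj₂ (s<s j<n)
    noncrossing : ∀ {a b c d} → a < b → γ a ≡ just b → c < d → γ c ≡ just d → ¬ (a < c × c < b × b < d)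
    noncrossing {a} {b} {c} {d} a<b e c<d e′ (a<c , c<b , b<d) with glue-arc {a} e | glue-arc {c} e′
    ... | outer′ | _ = <-asym a<b j<1+n
    ... | _ | outer′ = <-asym c<d j<1+n
    ... | left x | left y = S₁.noncrossing a<b x c<d y (a<c , c<b , b<d)
    ... | left x | outer = <-asym c<b (proj₂ (S₁.bounded x))
    ... | left x | inner {i = c′} _ = <-asym (<-trans c<b (proj₂ (S₁.bounded x))) (m≤n+m s c′)
    ... | outer | left y = <-asym a<c (proj₁ (S₁.bounded y))
    ... | outer | outer = <-irrefl refl a<c
    ... | outer | inner y = <-asym b<d (<∸⇒+suc<suc j≤n (proj₂ (S₂.bounded y)))
    ... | inner {i = a′} _ | left y = <-asym (<-trans a<c (proj₁ (S₁.bounded y))) (m≤n+m s a′)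
    ... | inner {i = a′} _ | outer = <-asym a<c (m≤n+m s a′)
    ... | inner {i = a′} {b′} x | inner {i = c′} {d′} y =
      S₂.noncrossing (+-cancelʳ-< s a′ b′ a<b) x (+-cancelʳ-< s c′ d′ c<d) y
        (+-cancelʳ-< s a′ c′ a<c , +-cancelʳ-< s c′ b′ c<b , +-cancelʳ-< s b′ d′ b<d)

  restrict-glue : restrict j γ ≗ π₁
  restrict-glue i with i <? j
  ... | yes i<j = glue-left i<j
  ... | no  i≮j = sym (Bounded⇒≡nothing S₁.bounded (≮⇒≥ i≮j))

  shiftDown-glue : shiftDown s k γ ≗ π₂
  shiftDown-glue i with i <? k
  ... | yes i<k = trans (cong (Maybe.map (_∸ s)) (glue-inner i<k)) shift-back
    where
    shift-back : Maybe.map (_∸ s) (Maybe.map (_+ s) (π₂ i)) ≡ π₂ i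
    shift-back with π₂ i
    ... | nothing = refl
    ... | just v  = cong just (m+n∸n≡m v s)
  ... | no  i≮k = sym (Bounded⇒≡nothing S₂.bounded (≮⇒≥ i≮k))

-- The recurrence for S1

module LastVertex (n : ℕ) where

  lastPartner : PartnerMap (suc (suc n)) → ℕ
  lastPartner p = maybe suc 0 (⟦ p ⟧ (suc n))

  lastPartner-0 : ∀ p → lastPartner p ≡ 0 → ⟦ p ⟧ (suc n) ≡ nothing
  lastPartner-0 p eq with ⟦ p ⟧ (suc n)
  ... | nothing = refl

  lastPartner-suc : ∀ p {j} → lastPartner p ≡ suc j → ⟦ p ⟧ (suc n) ≡ just j
  lastPartner-suc p eq with ⟦ p ⟧ (suc n)
  lastPartner-suc p refl | just _ = refl

  lastPartner< : ∀ p → lastPartner p < suc (suc (suc n))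
  lastPartner< p with ⟦ p ⟧ (suc n) in eq
  ... | nothing = z<s
  ... | just _  = s<s (proj₂ (⟦⟧-bounded p {suc n} eq))

  LastPartner : ℕ → PartnerMap (suc (suc n)) → Set
  LastPartner t p = IsSecStruct1 p × lastPartner p ≡ t

  lastPartner? : ∀ t → Decidable (LastPartner t)
  lastPartner? t = isSecStruct1? ∩? λ p → lastPartner p ≟ t

  countLast : ℕ → ℕ
  countLast t = count (lastPartner? t) (allPartnerMaps (suc (suc n)))

  lastPartner-toPartnerMap : ∀ {π} → Bounded (suc (suc n)) π →
                             lastPartner (toPartnerMap (suc (suc n)) π) ≡ maybe suc 0 (π (suc n))
  lastPartner-toPartnerMap π-bounded = cong (maybe suc 0) (⟦toPartnerMap⟧ _ π-bounded (suc n))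

  unpaired-bijection : Bijection (LastPartner 0) IsSecStruct1
  unpaired-bijection = record
    { to        = λ p → toPartnerMap (suc n) ⟦ p ⟧
    ; from      = λ q → toPartnerMap (suc (suc n)) ⟦ q ⟧
    ; to-resp   = toPartnerMap-isSecStruct1 ∘ shrunk
    ; from-resp = λ {q} h → toPartnerMap-isSecStruct1 (weakened q h) ,
        trans (lastPartner-toPartnerMap (bounded (weakened q h)))
              (cong (maybe suc 0) (Bounded⇒≡nothing (⟦⟧-bounded q) ≤-refl))
    ; from∘to   = λ {p} h → toPartnerMap-⟦⟧ p (⟦toPartnerMap⟧ _ (bounded (shrunk h)))
    ; to∘from   = λ {q} h → toPartnerMap-⟦⟧ q (⟦toPartnerMap⟧ _ (bounded (weakened q h))) }
    where
    open IsStructure using (bounded)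
    shrunk : ∀ {p} → LastPartner 0 p → IsStructure (suc n) ⟦ p ⟧
    shrunk {p} (h , last≡0) = isStructure-shrink (isSecStruct1⇒isStructure p h) (lastPartner-0 p last≡0)
    weakened : ∀ q → IsSecStruct1 q → IsStructure (suc (suc n)) ⟦ q ⟧
    weakened q = isStructure-weaken ∘ isSecStruct1⇒isStructure q

  paired-bijection : ∀ j → j < n → Bijection (LastPartner (suc j)) (IsSecStruct1 ⟨×⟩ IsSecStruct1)
  paired-bijection j j<n = record
    { to        = λ p → toPartnerMap j (restrict j ⟦ p ⟧) , toPartnerMap (n ∸ j) (shiftDown (suc j) (n ∸ j) ⟦ p ⟧)
    ; from      = λ (q₁ , q₂) → toPartnerMap (suc (suc n)) (glue j n ⟦ q₁ ⟧ ⟦ q₂ ⟧)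
    ; to-resp   = λ h → toPartnerMap-isSecStruct1 (Sp.restrict-isStructure h)
                      , toPartnerMap-isSecStruct1 (Sp.shiftDown-isStructure h)
    ; from-resp = λ {(q₁ , q₂)} h → toPartnerMap-isSecStruct1 (Gl.glue-isStructure q₁ q₂ h) ,
        trans (lastPartner-toPartnerMap (bounded (Gl.glue-isStructure q₁ q₂ h)))
              (cong (maybe suc 0) (Gl.glue-last q₁ q₂ h))
    ; from∘to   = λ {p} h → toPartnerMap-⟦⟧ p (λ i → trans
        (glue-cong j n (⟦toPartnerMap⟧ _ (bounded (Sp.restrict-isStructure h)))
                       (⟦toPartnerMap⟧ _ (bounded (Sp.shiftDown-isStructure h))) i)
        (Sp.glue-restrict-shiftDown h i))
    ; to∘from   = λ {(q₁ , q₂)} h → let γ-bounded = bounded (Gl.glue-isStructure q₁ q₂ h) in cong₂ _,_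
        (toPartnerMap-⟦⟧ q₁ (λ i → trans (restrict-cong j (⟦toPartnerMap⟧ _ γ-bounded) i)
                                         (Gl.restrict-glue q₁ q₂ h i)))
        (toPartnerMap-⟦⟧ q₂ (λ i → trans (shiftDown-cong (suc j) (n ∸ j) (⟦toPartnerMap⟧ _ γ-bounded) i)
                                         (Gl.shiftDown-glue q₁ q₂ h i))) }
    where
    open IsStructure using (bounded)
    module Sp {p} ((h , last≡1+j) : LastPartner (suc j) p) =
      Split n j j<n ⟦ p ⟧ (isSecStruct1⇒isStructure p h) (lastPartner-suc p last≡1+j)
    module Gl q₁ q₂ ((h₁ , h₂) : IsSecStruct1 q₁ × IsSecStruct1 q₂) =
      Glue n j j<n ⟦ q₁ ⟧ ⟦ q₂ ⟧ (isSecStruct1⇒isStructure q₁ h₁) (isSecStruct1⇒isStructure q₂ h₂)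

  countLast-unpaired : countLast 0 ≡ S1 (suc n)
  countLast-unpaired = count-bijection (lastPartner? 0) isSecStruct1?
    (allPartnerMaps-enumerates _) (allPartnerMaps-enumerates _) unpaired-bijection

  countLast-paired : ∀ j → j < n → countLast (suc j) ≡ S1 j * S1 (n ∸ j)
  countLast-paired j j<n = trans
    (count-bijection (lastPartner? (suc j)) (isSecStruct1? ×? isSecStruct1?) (allPartnerMaps-enumerates _)
      (enumerates-cartesianProduct (allPartnerMaps-enumerates j) (allPartnerMaps-enumerates (n ∸ j)))
      (paired-bijection j j<n))
    (count-cartesianProduct isSecStruct1? isSecStruct1? (allPartnerMaps j) (allPartnerMaps (n ∸ j)))

  countLast-short : ∀ t → n ≤ t → countLast (suc t) ≡ 0
  countLast-short t n≤t = count-none (lastPartner? (suc t)) (allPartnerMaps (suc (suc n))) too-short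
    where
    too-short : ∀ p → ¬ LastPartner (suc t) p
    too-short p (h , last≡1+t) with isSecStruct1⇒isStructure p h | lastPartner-suc p last≡1+t
    ... | s | e with IsStructure.long s e
    ...   | inj₁ 2+n<t = contradiction (proj₂ (IsStructure.bounded s {suc n} e)) (<⇒≯ 2+n<t)
    ...   | inj₂ 1+t<1+n = contradiction n≤t (<⇒≱ (s<s⁻¹ 1+t<1+n))

S1-recurrence : ∀ n → S1 (suc (suc n)) ≡ S1 (suc n) + ∑< n (λ j → S1 j * S1 (n ∸ j))
S1-recurrence n = begin
  S1 (suc (suc n))
    ≡⟨ count-partition isSecStruct1? lastPartner _ lastPartner< (allPartnerMaps (suc (suc n))) ⟩
  ∑< (suc n) countLast + countLast (suc n) + countLast (suc (suc n))
    ≡⟨ cong₂ (λ x y → ∑< (suc n) countLast + x + y) (countLast-short n ≤-refl) (countLast-short (suc n) (n≤1+n n)) ⟩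
  ∑< (suc n) countLast + 0 + 0
    ≡⟨ trans (+-identityʳ _) (+-identityʳ _) ⟩
  ∑< (suc n) countLast
    ≡⟨ ∑<-suc n countLast ⟩
  countLast 0 + ∑< n (λ j → countLast (suc j))
    ≡⟨ cong₂ _+_ countLast-unpaired (∑<-cong n countLast-paired) ⟩
  S1 (suc n) + ∑< n (λ j → S1 j * S1 (n ∸ j))
    ∎
  where
  open ≡-Reasoning
  open LastVertex n

theorem4 : (n : ℕ) → S1 (suc n) * S1 (suc n) ≤ S1 n * S1 (suc (suc n))
theorem4 = convolution-recurrence⇒logConvex S1 refl refl S1-recurrence
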